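{- Let \(G\) be a directed Eulerian multigraph in which every vertex \(v\) has degree \(d_v\ge2\), and let \(G^\star\) be obtained by replacing each vertex \(v\) by a \(d_v\)-wire switching network in which every wire passes through at least one switch (incoming arcs of \(v\) attached to the input ports, outgoing arcs to the output ports, ports then suppressed). Fix a transition system \(T\) of \(G\); for each vertex \(v\) choose a switch setting of its network whose induced permutation equals the local permutation of \(T\) at \(v\), and let \(T^\star\) be the resulting transition system of \(G^\star\). Then \(T^\star\) and \(T\) have the same number of cycles. Conversely, every transition system of \(G^\star\) that is an Eulerian tour projects to an Eulerian tour of \(G\).
   Context: A transition system assigns to each vertex a bijection from its incoming incidences to its outgoing incidences and induces a permutation of the arcs (an arc is followed by the image of its incoming incidence at its head); its cycles are the cycles of this permutation, and it is an Eulerian tour if there is exactly one. A \(d\)-wire switching network is a directed acyclic gadget with \(d\) input ports, \(d\) output ports and switch vertices, each switch having two incoming and two outgoing wire segments; a switch setting is a choice of one of the two bijections at each switch, and following paths from inputs to outputs gives a permutation of \([d]\). In \(G^\star\), ports are suppressed: each maximal directed path through ports is replaced by one arc, so every vertex of \(G^\star\) is a switch. Transition systems of \(G^\star\) are exactly switch settings of all networks, and such a setting projects to the transition system of \(G\) whose local permutation at \(v\) is the permutation induced by the network of \(v\) (identifying input \(j\) with the \(j\)th incoming arc and output \(j\) with the \(j\)th outgoing arc of \(v\)). -}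

module Defs where

open import Data.Nat using (ℕ; zero; suc; _≤_)
open import Data.Fin using (Fin; zero; suc)
open import Data.Bool using (Bool; true; false)
open import Data.Product using (Σ; ∃; _×_; _,_; proj₁; proj₂)
open import Data.Sum using (_⊎_; inj₁; inj₂)
open import Relation.Nullary using (¬_)
open import Relation.Binary.PropositionalEquality using (_≡_; refl)
open import Relation.Binary.Construct.Closure.Transitive using (TransClosure)
open import Function.Bundles using (_↔_; Inverse)

iter : ∀ {A : Set} → (A → A) → ℕ → A → A
iter p zero    x = x
iter p (suc k) x = p (iter p k x)

SameCycle : ∀ {A : Set} → (A → A) → A → A → Set
SameCycle p x y = ∃ λ k → iter p k x ≡ y

HasCycles : ∀ {A : Set} → (A → A) → ℕ → Set
HasCycles {A} p c =
  Σ (Fin c → A) λ r →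
    (x : A) → Σ (Fin c) λ i →
      SameCycle p (r i) x × ((j : Fin c) → SameCycle p (r j) x → j ≡ i)

IsEulerianTour : ∀ {A : Set} → (A → A) → Set
IsEulerianTour p = HasCycles p 1

-- Every vertex v has in-degree = out-degree = deg v (Eulerian), witnessed
-- by enumerations of its incoming / outgoing incidences
-- ("the j-th incoming arc", "the j-th outgoing arc").

record Graph : Set where
  field
    n   : ℕ
    m   : ℕ
    tl  : Fin m → Fin n
    hd  : Fin m → Fin n
    deg : Fin n → ℕ
  In : Fin n → Set
  In v = Σ (Fin m) λ a → hd a ≡ v
  Out : Fin n → Set
  Out v = Σ (Fin m) λ a → tl a ≡ v
  field
    inc  : (v : Fin n) → Fin (deg v) ↔ In v
    outc : (v : Fin n) → Fin (deg v) ↔ Out v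

open Graph public using (In; Out)

TransitionSystem : Graph → Set
TransitionSystem G = (v : Fin (Graph.n G)) → In G v ↔ Out G v

arcPerm : (G : Graph) → TransitionSystem G → Fin (Graph.m G) → Fin (Graph.m G)
arcPerm G T a = proj₁ (Inverse.to (T (Graph.hd G a)) (a , refl))

localPerm : (G : Graph) → TransitionSystem G → (v : Fin (Graph.n G))
          → Fin (Graph.deg G v) → Fin (Graph.deg G v)
localPerm G T v j =
  Inverse.from (Graph.outc G v) (Inverse.to (T v) (Inverse.to (Graph.inc G v) j))

-- Switches Fin s, each with two in-slots and two out-slots (Slot s).
-- Wire segments: a bijection from sources (input ports ⊎ switch
-- out-slots) to targets (output ports ⊎ switch in-slots).

Slot : ℕ → Set
Slot s = Fin s × Fin 2

record Network (d : ℕ) : Set where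
  field
    s      : ℕ
    wiring : (Fin d ⊎ Slot s) ↔ (Fin d ⊎ Slot s)
  Edge : Fin s → Fin s → Set
  Edge i j = ∃ λ k → ∃ λ k′ → Inverse.to wiring (inj₂ (i , k)) ≡ inj₂ (j , k′)
  field
    acyclic : (i : Fin s) → ¬ TransClosure Edge i i

-- every wire passes through at least one switch: no segment goes
-- directly from an input port to an output port
ThroughSwitch : ∀ {d} → Network d → Set
ThroughSwitch {d} N =
  (j : Fin d) → ∃ λ t → Inverse.to (Network.wiring N) (inj₁ j) ≡ inj₂ t

-- A switch setting: one of the two bijections at each switch
-- (false = straight, true = crossed)
Setting : ∀ {d} → Network d → Set
Setting N = Fin (Network.s N) → Bool

swap2 : Fin 2 → Fin 2
swap2 zero       = suc zero
swap2 (suc zero) = zero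

apply : Bool → Fin 2 → Fin 2
apply false k = k
apply true  k = swap2 k

data Reaches {d} (N : Network d) (σ : Setting N)
     : (Fin d ⊎ Slot (Network.s N)) → Fin d → Set where
  done : ∀ {src o} → Inverse.to (Network.wiring N) src ≡ inj₁ o → Reaches N σ src o
  step : ∀ {src o i k} → Inverse.to (Network.wiring N) src ≡ inj₂ (i , k)
       → Reaches N σ (inj₂ (i , apply (σ i) k)) o → Reaches N σ src o

Induces : ∀ {d} (N : Network d) → Setting N → (Fin d → Fin d) → Set
Induces {d} N σ π = (j : Fin d) → Reaches N σ (inj₁ j) (π j)

-- Every vertex of G⋆ is a switch; each arc of G⋆ (a
-- maximal path through ports) starts at a unique switch out-slot, so
-- the arcs of G⋆ are indexed by the switch out-slots.

module Star (G : Graph) (N : (v : Fin (Graph.n G)) → Network (Graph.deg G v))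
            (ts : (v : Fin (Graph.n G)) → ThroughSwitch (N v)) where
  open Graph G

  StarSlot : Set
  StarSlot = Σ (Fin n) λ v → Slot (Network.s (N v))

  StarArc : Set
  StarArc = StarSlot

  -- head in-slot of the arc whose segment from out-slot of v ends at t
  headFrom : (v : Fin n) → Fin (deg v) ⊎ Slot (Network.s (N v)) → StarSlot
  headFrom v (inj₂ t) = v , t
  headFrom v (inj₁ j) =
    let a = proj₁ (Inverse.to (outc v) j)
        w = hd a
        i = Inverse.from (inc w) (a , refl)
    in w , proj₁ (ts w i)

  starHead : StarArc → StarSlot
  starHead (v , t) = headFrom v (Inverse.to (Network.wiring (N v)) (inj₂ t))

  -- switch settings of all networks = transition systems of G⋆
  Settings : Set
  Settings = (v : Fin n) → Setting (N v)

  -- the arc permutation of the transition system of G⋆ given by S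
  starPerm : Settings → StarArc → StarArc
  starPerm S α with starHead α
  ... | w , (i , k) = w , (i , apply (S w i) k)

-- Suppressing the ports merges each arc a of G into an arc starArc a of G⋆.
-- Under T⋆ the path from starArc a crosses the network at the head of a and
-- meets no other merged arc before starArc (T a), because the switch setting
-- induces the local permutation of T there. So T⋆ subdivides T; as the
-- networks are acyclic, walks through them terminate in both directions and
-- every arc of G⋆ lies between two merged arcs, so the cycles of T and T⋆
-- correspond. Conversely, acyclicity also makes the permutation induced by
-- any setting a bijection; the transition system it defines is induced by
-- the setting, hence has one cycle by the first part.

module Submission where

open import Defs
open import Data.Bool using (Bool; true; false)
open import Data.Fin using (Fin; zero; suc)
open import Data.Fin.Induction using (spo-wellFounded; spo-noetherian)
open import Data.Maybe using (Maybe; just; nothing)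
open import Data.Maybe.Properties using (just-injective)
open import Data.Nat using (ℕ; zero; suc; _+_; _∸_; _≤_; _<_; s≤s)
open import Data.Nat.Induction using (<-wellFounded)
open import Data.Nat.Properties using (_≤?_; ≰⇒>; m∸n≤m; m∸n+n≡m)
open import Data.Product using (Σ; ∃; _×_; _,_; proj₁; proj₂)
open import Data.Sum using (_⊎_; inj₁; inj₂; [_,_]′)
open import Data.Sum.Properties using (inj₁-injective; inj₂-injective)
open import Function using (_∘_; const; flip)
open import Function.Bundles using (_↔_; _⇔_; Inverse; Injection; Equivalence; mk⇔; mk↔ₛ′)
open import Function.Construct.Composition using (_↔-∘_)
open import Function.Construct.Symmetry using (↔-sym)
open import Function.Definitions using (Injective)
open import Function.Properties.Inverse using (↔⇒↣)
open import Induction.WellFounded using (WellFounded; Acc; acc; module Subrelation)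
open import Relation.Binary.Construct.Closure.Transitive using (TransClosure; [_]; _++_)
open import Relation.Binary.PropositionalEquality
open import Relation.Binary.Structures using (IsStrictPartialOrder)
open import Relation.Nullary using (yes; no; contradiction)

iter-+ : ∀ {A : Set} (p : A → A) k l x → iter p (k + l) x ≡ iter p k (iter p l x)
iter-+ p zero    l x = refl
iter-+ p (suc k) l x = cong p (iter-+ p k l x)

iter-suc : ∀ {A : Set} (p : A → A) k x → iter p (suc k) x ≡ iter p k (p x)
iter-suc p zero    x = refl
iter-suc p (suc k) x = cong p (iter-suc p k x)

module _ {A : Set} {p : A → A} where

  SameCycle-refl : ∀ {x} → SameCycle p x x
  SameCycle-refl = 0 , refl

  SameCycle-step : ∀ {x} → SameCycle p x (p x)
  SameCycle-step = 1 , refl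

  SameCycle-trans : ∀ {x y z} → SameCycle p x y → SameCycle p y z → SameCycle p x z
  SameCycle-trans {x} (k , refl) (l , refl) = l + k , iter-+ p l k x

  sameRepresentative : ∀ {c} (h : HasCycles p c) {x i j} →
                       SameCycle p (proj₁ h i) x → SameCycle p (proj₁ h j) x → i ≡ j
  sameRepresentative (_ , cycleOf) {x} {i} {j} ri↝x rj↝x =
    let (_ , _ , unique) = cycleOf x in trans (unique i ri↝x) (sym (unique j rj↝x))

module _ {A B : Set} (q : B → B) (f : A → B) where

  OffImage : B → Set
  OffImage b = ∀ a → b ≢ f a

  FirstHit : B → A → Set
  FirstHit b a = Σ ℕ λ k → iter q k b ≡ f a × (∀ {j} → j < k → OffImage (iter q j b))

  firstHit-here : ∀ {b a} → b ≡ f a → FirstHit b a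
  firstHit-here b≡fa = 0 , b≡fa , λ ()

  firstHit-step : ∀ {b a} → OffImage b → FirstHit (q b) a → FirstHit b a
  firstHit-step {b} b-off (k , hit , before) = suc k , trans (iter-suc q k b) hit , earlier
    where
    earlier : ∀ {j} → j < suc k → OffImage (iter q j b)
    earlier {zero}  _         = b-off
    earlier {suc j} (s≤s j<k) = subst OffImage (sym (iter-suc q j b)) (before j<k)

  firstHit⇒SameCycle : ∀ {b a} → FirstHit b a → SameCycle q b (f a)
  firstHit⇒SameCycle (k , hit , _) = k , hit

  firstHit-first : ∀ {b a a′} l → FirstHit b a → iter q l b ≡ f a′ →
                   Σ ℕ λ l′ → l′ ≤ l × iter q l′ (f a) ≡ f a′
  firstHit-first {b} {a} {a′} l (k , hit , before) later with k ≤? l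
  ... | no  k≰l = contradiction later (before (≰⇒> k≰l) a′)
  ... | yes k≤l = l ∸ k , m∸n≤m l k , (begin
    iter q (l ∸ k) (f a)          ≡⟨ cong (iter q (l ∸ k)) hit ⟨
    iter q (l ∸ k) (iter q k b)   ≡⟨ iter-+ q (l ∸ k) k b ⟨
    iter q (l ∸ k + k) b          ≡⟨ cong (λ i → iter q i b) (m∸n+n≡m k≤l) ⟩
    iter q l b                    ≡⟨ later ⟩
    f a′                          ∎)
    where open ≡-Reasoning

-- q subdivides p along f: each step from a to p a becomes a q-path from f a
-- to f (p a) that avoids the image of f in between, and every element of B
-- lies on such a path.
module Subdivision {A B : Set} (p : A → A) (q : B → B) (f : A → B)
  (f-injective : Injective _≡_ _≡_ f)
  (next : ∀ a → FirstHit q f (q (f a)) (p a))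
  (firstHit-exists : ∀ b → Σ A (FirstHit q f b))
  (entered : ∀ b → Σ A λ a → SameCycle q (f a) b)
  where

  sameCycle-preserved : ∀ {a a′} → SameCycle p a a′ → SameCycle q (f a) (f a′)
  sameCycle-preserved     (zero  , refl) = SameCycle-refl
  sameCycle-preserved {a} (suc k , refl) =
    SameCycle-trans (sameCycle-preserved (k , refl))
      (SameCycle-trans SameCycle-step (firstHit⇒SameCycle q f (next (iter p k a))))

  sameCycle-reflectedAcc : ∀ {a a′} k → Acc _<_ k → iter q k (f a) ≡ f a′ →
                           SameCycle p a a′
  sameCycle-reflectedAcc         zero    _          fa≡fa′ = 0 , f-injective fa≡fa′
  sameCycle-reflectedAcc {a} {a′} (suc k) (acc rec) hit
    with firstHit-first q f k (next a) (trans (sym (iter-suc q k (f a))) hit)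
  ... | l , l≤k , hit′ =
    SameCycle-trans SameCycle-step (sameCycle-reflectedAcc l (rec (s≤s l≤k)) hit′)

  sameCycle-reflected : ∀ {a a′} → SameCycle q (f a) (f a′) → SameCycle p a a′
  sameCycle-reflected (k , hit) = sameCycle-reflectedAcc k (<-wellFounded k) hit

  hasCycles⇒ : ∀ {c} → HasCycles p c → HasCycles q c
  hasCycles⇒ h@(r , cycleOf) = f ∘ r , λ b →
    let (a , fa↝b)       = entered b
        (i , ri↝a , _)   = cycleOf a
        (a′ , b-hits-a′) = firstHit-exists b
        b↝fa′            = firstHit⇒SameCycle q f b-hits-a′
        fri↝b            = SameCycle-trans (sameCycle-preserved ri↝a) fa↝b
    in i , fri↝b , λ j frj↝b →
         sameRepresentative h (sameCycle-reflected (SameCycle-trans frj↝b b↝fa′))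
                              (sameCycle-reflected (SameCycle-trans fri↝b b↝fa′))

  hasCycles⇐ : ∀ {c} → HasCycles q c → HasCycles p c
  hasCycles⇐ h@(r , cycleOf) = proj₁ ∘ firstHit-exists ∘ r , λ a →
    let (i , ri↝fa@(l , hit) , _) = cycleOf (f a)
        (l′ , _ , hit′)          = firstHit-first q f l (proj₂ (firstHit-exists (r i))) hit
    in i , sameCycle-reflected (l′ , hit′) , λ j gj↝a →
         sameRepresentative h
           (SameCycle-trans (firstHit⇒SameCycle q f (proj₂ (firstHit-exists (r j))))
                            (sameCycle-preserved gj↝a))
           ri↝fa

  hasCycles⇔ : ∀ {c} → HasCycles p c ⇔ HasCycles q c
  hasCycles⇔ = mk⇔ hasCycles⇒ hasCycles⇐

module _ {d} (N : Network d) where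
  open Network N

  Edge⁺-isStrictPartialOrder : IsStrictPartialOrder _≡_ (TransClosure Edge)
  Edge⁺-isStrictPartialOrder = record
    { isEquivalence = isEquivalence
    ; irrefl        = λ { refl → acyclic _ }
    ; trans         = _++_
    ; <-resp-≈      = resp₂ (TransClosure Edge)
    }

  Edge-wellFounded : WellFounded Edge
  Edge-wellFounded = Subrelation.wellFounded [_] (spo-wellFounded Edge⁺-isStrictPartialOrder)

  Edge-noetherian : WellFounded (flip Edge)
  Edge-noetherian = Subrelation.wellFounded [_] (spo-noetherian Edge⁺-isStrictPartialOrder)

  wire : Fin d ⊎ Slot s → Fin d ⊎ Slot s
  wire = Inverse.to wiring

  wire-injective : Injective _≡_ _≡_ wire
  wire-injective = Injection.injective (↔⇒↣ wiring)

  input↛output : ThroughSwitch N → ∀ {j o} → wire (inj₁ j) ≢ inj₁ o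
  input↛output ts {j} j↦o = contradiction (trans (sym j↦o) (proj₂ (ts j))) λ ()

  exitOf : ThroughSwitch N → ∀ o → ∃ λ t → wire (inj₂ t) ≡ inj₁ o
  exitOf ts o with Inverse.from wiring (inj₁ o) | Inverse.strictlyInverseˡ wiring (inj₁ o)
  ... | inj₁ j | j↦o = contradiction j↦o (input↛output ts)
  ... | inj₂ t | t↦o = t , t↦o

apply-involutive : ∀ b k → apply b (apply b k) ≡ k
apply-involutive false k          = refl
apply-involutive true  zero       = refl
apply-involutive true  (suc zero) = refl

-- A slot serves both as an in-slot and as an out-slot of its switch; turn σ
-- maps each to the one it is connected to under σ.
turn : ∀ {s} → (Fin s → Bool) → Slot s → Slot s
turn σ (i , k) = i , apply (σ i) k

turn-involutive : ∀ {s} (σ : Fin s → Bool) t → turn σ (turn σ t) ≡ t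
turn-involutive σ (i , k) = cong (i ,_) (apply-involutive (σ i) k)

turn-injective : ∀ {s} (σ : Fin s → Bool) → Injective _≡_ _≡_ (turn σ)
turn-injective σ {t} {t′} eq =
  trans (sym (turn-involutive σ t)) (trans (cong (turn σ) eq) (turn-involutive σ t′))

module Paths {d} (N : Network d) (σ : Setting N) where
  open Network N using (s; wiring; Edge)

  data Visits (j : Fin d) : Slot s → Set where
    enter : ∀ {u} → wire N (inj₁ j) ≡ inj₂ u → Visits j u
    pass  : ∀ {u′ u} → Visits j u′ → wire N (inj₂ (turn σ u′)) ≡ inj₂ u → Visits j u

  Exits : Fin d → Fin d → Set
  Exits j o = ∃ λ u → Visits j u × wire N (inj₂ (turn σ u)) ≡ inj₁ o

  reaches-functional : ∀ {x o o′} → Reaches N σ x o → Reaches N σ x o′ → o ≡ o′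
  reaches-functional (done x↦o)   (done x↦o′)   = inj₁-injective (trans (sym x↦o) x↦o′)
  reaches-functional (done x↦o)   (step x↦u _)  = contradiction (trans (sym x↦o) x↦u) λ ()
  reaches-functional (step x↦u _) (done x↦o)    = contradiction (trans (sym x↦o) x↦u) λ ()
  reaches-functional (step x↦u r) (step x↦u′ r′) with trans (sym x↦u) x↦u′
  ... | refl = reaches-functional r r′

  visits-functional : ∀ {j j′ u} → Visits j u → Visits j′ u → j ≡ j′
  visits-functional (enter j↦u)  (enter j′↦u) =
    inj₁-injective (wire-injective N (trans j↦u (sym j′↦u)))
  visits-functional (enter j↦u)  (pass _ t↦u) =
    contradiction (wire-injective N (trans j↦u (sym t↦u))) λ ()
  visits-functional (pass _ t↦u) (enter j↦u)  =
    contradiction (wire-injective N (trans j↦u (sym t↦u))) λ ()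
  visits-functional (pass v t↦u) (pass v′ t′↦u)
    with turn-injective σ (inj₂-injective (wire-injective N (trans t↦u (sym t′↦u))))
  ... | refl = visits-functional v v′

  exits-injective : ∀ {j j′ o} → Exits j o → Exits j′ o → j ≡ j′
  exits-injective (_ , v , t↦o) (_ , v′ , t′↦o)
    with turn-injective σ (inj₂-injective (wire-injective N (trans t↦o (sym t′↦o))))
  ... | refl = visits-functional v v′

  visits-reaches : ∀ {j u o} → Visits j u → Reaches N σ (inj₂ (turn σ u)) o →
                   Reaches N σ (inj₁ j) o
  visits-reaches (enter j↦u)  r = step j↦u r
  visits-reaches (pass v t↦u) r = visits-reaches v (step t↦u r)

  exits⇒reaches : ∀ {j o} → Exits j o → Reaches N σ (inj₁ j) o
  exits⇒reaches (_ , v , t↦o) = visits-reaches v (done t↦o)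

  visits-exits : ∀ {j u o} → Visits j u → Reaches N σ (inj₂ (turn σ u)) o → Exits j o
  visits-exits v (done t↦o)   = _ , v , t↦o
  visits-exits v (step t↦u r) = visits-exits (pass v t↦u) r

  reachesAcc : ∀ i → Acc (flip Edge) i → ∀ k → ∃ (Reaches N σ (inj₂ (i , k)))
  reachesAcc i (acc rec) k with wire N (inj₂ (i , k)) in t↦x
  ... | inj₁ o       = o , done t↦x
  ... | inj₂ (i′ , k′) =
    let (o , r) = reachesAcc i′ (rec (k , k′ , t↦x)) (apply (σ i′) k′)
    in o , step t↦x r

  reaches : ∀ t → ∃ (Reaches N σ (inj₂ t))
  reaches (i , k) = reachesAcc i (Edge-noetherian N i) k

  visitedAcc : ∀ i → Acc Edge i → ∀ k → ∃ λ j → Visits j (i , k)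
  visitedAcc i (acc rec) k
    with Inverse.from wiring (inj₂ (i , k)) | Inverse.strictlyInverseˡ wiring (inj₂ (i , k))
  ... | inj₁ j         | j↦u = j , enter j↦u
  ... | inj₂ (i′ , k′) | t↦u =
    let (j , v) = visitedAcc i′ (rec (k′ , k , t↦u)) (apply (σ i′) k′)
    in j , pass v (subst (λ t → wire N (inj₂ t) ≡ _) (sym (turn-involutive σ _)) t↦u)

  visited : ∀ u → ∃ λ j → Visits j u
  visited (i , k) = visitedAcc i (Edge-wellFounded N i) k

-- Backward walks from an output are as deterministic as forward walks from
-- an input, which is what makes the induced permutation invertible.
module _ {d} (N : Network d) (ts : ThroughSwitch N) (σ : Setting N) where
  open Paths N σ

  reaches⇒exits : ∀ {j o} → Reaches N σ (inj₁ j) o → Exits j o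
  reaches⇒exits (done j↦o)   = contradiction j↦o (input↛output N ts)
  reaches⇒exits (step j↦u r) = visits-exits (enter j↦u) r

  exited : ∀ o → ∃ λ j → Exits j o
  exited o =
    let (t , t↦o) = exitOf N ts o
        (j , v)   = visited (turn σ t)
    in j , turn σ t , v ,
       subst (λ t′ → wire N (inj₂ t′) ≡ inj₁ o) (sym (turn-involutive σ t)) t↦o

  inducedBijection : Σ (Fin d ↔ Fin d) λ π → Induces N σ (Inverse.to π)
  inducedBijection = mk↔ₛ′ π ρ π∘ρ ρ∘π , π-induces
    where
    inputReaches : ∀ j → ∃ (Reaches N σ (inj₁ j))
    inputReaches j =
      let (u , j↦u) = ts j
          (o , r)   = reaches (turn σ u)
      in o , step j↦u r

    π ρ : Fin d → Fin d
    π = proj₁ ∘ inputReaches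
    ρ = proj₁ ∘ exited

    π-induces : Induces N σ π
    π-induces = proj₂ ∘ inputReaches

    π∘ρ : ∀ o → π (ρ o) ≡ o
    π∘ρ o = reaches-functional (π-induces (ρ o)) (exits⇒reaches (proj₂ (exited o)))

    ρ∘π : ∀ j → ρ (π j) ≡ j
    ρ∘π j = exits-injective (proj₂ (exited (π j))) (reaches⇒exits (π-induces j))

module Projection (G : Graph) (N : (v : Fin (Graph.n G)) → Network (Graph.deg G v))
                  (ts : (v : Fin (Graph.n G)) → ThroughSwitch (N v)) where
  open Graph G
  open Star G N ts

  inArc outArc : (v : Fin n) → Fin (deg v) → Fin m
  inArc  v j = proj₁ (Inverse.to (inc v) j)
  outArc v o = proj₁ (Inverse.to (outc v) o)

  inPort : (a : Fin m) → Fin (deg (hd a))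
  inPort a = Inverse.from (inc (hd a)) (a , refl)

  outPort : (a : Fin m) → Fin (deg (tl a))
  outPort a = Inverse.from (outc (tl a)) (a , refl)

  exitSlot entrySlot : (v : Fin n) → Fin (deg v) → Slot (Network.s (N v))
  exitSlot  v o = proj₁ (exitOf (N v) (ts v) o)
  entrySlot v j = proj₁ (ts v j)

  exitSlot-wired : ∀ v o → wire (N v) (inj₂ (exitSlot v o)) ≡ inj₁ o
  exitSlot-wired v o = proj₂ (exitOf (N v) (ts v) o)

  exitSlot-unique : ∀ {v t o} → wire (N v) (inj₂ t) ≡ inj₁ o → t ≡ exitSlot v o
  exitSlot-unique {v} {o = o} t↦o =
    inj₂-injective (wire-injective (N v) (trans t↦o (sym (exitSlot-wired v o))))

  entrySlot-unique : ∀ {v j u} → wire (N v) (inj₁ j) ≡ inj₂ u → entrySlot v j ≡ u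
  entrySlot-unique {v} {j} j↦u = inj₂-injective (trans (sym (proj₂ (ts v j))) j↦u)

  starArc : Fin m → StarArc
  starArc a = tl a , exitSlot (tl a) (outPort a)

  outArc-outPort : ∀ a → outArc (tl a) (outPort a) ≡ a
  outArc-outPort a = cong proj₁ (Inverse.strictlyInverseˡ (outc (tl a)) (a , refl))

  outPort-unique : ∀ {a o} → Inverse.to (outc (tl a)) o ≡ (a , refl) → outPort a ≡ o
  outPort-unique {a} {o} o↦a =
    trans (cong (Inverse.from (outc (tl a))) (sym o↦a)) (Inverse.strictlyInverseʳ (outc (tl a)) o)

  inPort-unique : ∀ {a j} → Inverse.to (inc (hd a)) j ≡ (a , refl) → inPort a ≡ j
  inPort-unique {a} {j} j↦a =
    trans (cong (Inverse.from (inc (hd a))) (sym j↦a)) (Inverse.strictlyInverseʳ (inc (hd a)) j)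

  starArc-outArc : ∀ v o → starArc (outArc v o) ≡ (v , exitSlot v o)
  starArc-outArc v o = go (Inverse.to (outc v) o) refl
    where
    go : ∀ b → Inverse.to (outc v) o ≡ b → starArc (proj₁ b) ≡ (v , exitSlot v o)
    go (a , refl) o↦a = cong (λ o′ → tl a , exitSlot (tl a) o′) (outPort-unique o↦a)

  starHead-starArc : ∀ a → starHead (starArc a) ≡ (hd a , entrySlot (hd a) (inPort a))
  starHead-starArc a =
    trans (cong (headFrom (tl a)) (exitSlot-wired (tl a) (outPort a)))
          (cong (λ b → hd b , entrySlot (hd b) (inPort b)) (outArc-outPort a))

  starHead-inArc : ∀ v j → starHead (starArc (inArc v j)) ≡ (v , entrySlot v j)
  starHead-inArc v j = go (Inverse.to (inc v) j) refl
    where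
    go : ∀ b → Inverse.to (inc v) j ≡ b → starHead (starArc (proj₁ b)) ≡ (v , entrySlot v j)
    go (a , refl) j↦a =
      trans (starHead-starArc a) (cong (λ j′ → hd a , entrySlot (hd a) j′) (inPort-unique j↦a))

  arcAt : (v : Fin n) → Fin (deg v) ⊎ Slot (Network.s (N v)) → Maybe (Fin m)
  arcAt v = [ just ∘ outArc v , const nothing ]′

  arcOf : StarArc → Maybe (Fin m)
  arcOf (v , t) = arcAt v (wire (N v) (inj₂ t))

  arcOf-starArc : ∀ a → arcOf (starArc a) ≡ just a
  arcOf-starArc a =
    trans (cong (arcAt (tl a)) (exitSlot-wired (tl a) (outPort a)))
          (cong just (outArc-outPort a))

  starArc-injective : Injective _≡_ _≡_ starArc
  starArc-injective {a} {a′} eq =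
    just-injective (trans (sym (arcOf-starArc a)) (trans (cong arcOf eq) (arcOf-starArc a′)))

  starPerm-≡ : ∀ S α {w u} → starHead α ≡ (w , u) → starPerm S α ≡ (w , turn (S w) u)
  starPerm-≡ S α eq with starHead α
  starPerm-≡ S α refl | _ = refl

  module _ (S : Settings) where
    open module P {v : Fin n} = Paths (N v) (S v) using (Visits; enter; pass; reaches; visited)

    q : StarArc → StarArc
    q = starPerm S

    offImage : ∀ {v t u} → wire (N v) (inj₂ t) ≡ inj₂ u → OffImage q starArc (v , t)
    offImage t↦u a refl = contradiction (trans (sym (exitSlot-wired (tl a) (outPort a))) t↦u) λ ()

    reaches⇒firstHit : ∀ {v t o} → Reaches (N v) (S v) (inj₂ t) o →
                       FirstHit q starArc (v , t) (outArc v o)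
    reaches⇒firstHit {v} {o = o} (done t↦o) = firstHit-here q starArc
      (trans (cong (v ,_) (exitSlot-unique t↦o)) (sym (starArc-outArc v o)))
    reaches⇒firstHit {v} {t} (step t↦u r) =
      firstHit-step q starArc (offImage t↦u)
        (subst (λ α → FirstHit q starArc α _)
          (sym (starPerm-≡ S (v , t) (cong (headFrom v) t↦u)))
          (reaches⇒firstHit r))

    visits⇒sameCycle : ∀ {v j u} → Visits j u →
                       SameCycle q (starArc (inArc v j)) (v , turn (S v) u)
    visits⇒sameCycle {v} {j} (enter j↦u) =
      1 , starPerm-≡ S _ (trans (starHead-inArc v j) (cong (v ,_) (entrySlot-unique j↦u)))
    visits⇒sameCycle {v} (pass {u′} w t↦u) =
      SameCycle-trans (visits⇒sameCycle w)
        (1 , starPerm-≡ S (v , turn (S v) u′) (cong (headFrom v) t↦u))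

    firstHit-exists : ∀ α → Σ (Fin m) (FirstHit q starArc α)
    firstHit-exists (v , t) = let (o , r) = reaches t in outArc v o , reaches⇒firstHit r

    entered : ∀ α → Σ (Fin m) λ a → SameCycle q (starArc a) α
    entered (v , t) =
      let (j , w) = visited (turn (S v) t)
      in inArc v j ,
         subst (SameCycle q _) (cong (v ,_) (turn-involutive (S v) t)) (visits⇒sameCycle w)

    module _ (T : TransitionSystem G) where

      outArc-localPerm : ∀ a → outArc (hd a) (localPerm G T (hd a) (inPort a)) ≡ arcPerm G T a
      outArc-localPerm a = trans (cong proj₁ (Inverse.strictlyInverseˡ (outc (hd a)) _))
        (cong (proj₁ ∘ Inverse.to (T (hd a))) (Inverse.strictlyInverseˡ (inc (hd a)) (a , refl)))

      inputReaches⇒firstHit : ∀ a {o} → Reaches (N (hd a)) (S (hd a)) (inj₁ (inPort a)) o →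
                              FirstHit q starArc (q (starArc a)) (outArc (hd a) o)
      inputReaches⇒firstHit a (done j↦o) =
        contradiction j↦o (input↛output (N (hd a)) (ts (hd a)))
      inputReaches⇒firstHit a {o} (step j↦u r) =
        subst (λ α → FirstHit q starArc α (outArc (hd a) o))
          (sym (starPerm-≡ S (starArc a)
            (trans (starHead-starArc a) (cong (hd a ,_) (entrySlot-unique j↦u)))))
          (reaches⇒firstHit r)

      hasCycles⇔ : ((v : Fin n) → Induces (N v) (S v) (localPerm G T v)) →
                   ∀ {c} → HasCycles (arcPerm G T) c ⇔ HasCycles q c
      hasCycles⇔ induces = Subdivision.hasCycles⇔ (arcPerm G T) q starArc
        starArc-injective next firstHit-exists entered
        where
        next : ∀ a → FirstHit q starArc (q (starArc a)) (arcPerm G T a)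
        next a = subst (FirstHit q starArc _) (outArc-localPerm a)
          (inputReaches⇒firstHit a (induces (hd a) (inPort a)))

    projection : TransitionSystem G
    projection v = outc v ↔-∘ (proj₁ (inducedBijection (N v) (ts v) (S v)) ↔-∘ ↔-sym (inc v))

    projection-induces : (v : Fin n) → Induces (N v) (S v) (localPerm G projection v)
    projection-induces v j = subst (Reaches (N v) (S v) (inj₁ j)) (sym localPerm≡π)
      (proj₂ (inducedBijection (N v) (ts v) (S v)) j)
      where
      π = Inverse.to (proj₁ (inducedBijection (N v) (ts v) (S v)))
      localPerm≡π : localPerm G projection v j ≡ π j
      localPerm≡π = trans (Inverse.strictlyInverseʳ (outc v) _)
                          (cong π (Inverse.strictlyInverseʳ (inc v) j))

lemma6p3 : (G : Graph)
           (N : (v : Fin (Graph.n G)) → Network (Graph.deg G v))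
           → ((v : Fin (Graph.n G)) → 2 ≤ Graph.deg G v)
           → (ts : (v : Fin (Graph.n G)) → ThroughSwitch (N v))
           → ((T : TransitionSystem G) (S : Star.Settings G N ts)
              → ((v : Fin (Graph.n G)) → Induces (N v) (S v) (localPerm G T v))
              → (c : ℕ)
              → HasCycles (arcPerm G T) c ⇔ HasCycles (Star.starPerm G N ts S) c)
           × ((S : Star.Settings G N ts)
              → IsEulerianTour (Star.starPerm G N ts S)
              → Σ (TransitionSystem G) λ T →
                  ((v : Fin (Graph.n G)) → Induces (N v) (S v) (localPerm G T v))
                  × IsEulerianTour (arcPerm G T))
lemma6p3 G N _ ts =
  (λ T S induces _ → hasCycles⇔ S T induces) ,
  λ S tour → projection S , projection-induces S ,
             Equivalence.from (hasCycles⇔ S (projection S) (projection-induces S)) tour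
  where open Projection G N ts
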